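{- For each $n\ge0$ and $e\in\mathbf{I}_n(\underline{10}0)$, assign the label $L(e)=(a,b)=(|A_{\ge}(e)|,|B_{<}(e)|)$. Then the empty sequence has label $(1,0)$, and if $e\in\mathbf{I}_n(\underline{10}0)$ has label $(a,b)$, then the multiset of labels $\{L(eh): h \text{ an active site of } e\}$ equals the multiset consisting of $(a+2-i,\,b-1+i)$ for $i=1,\dots,a$ together with $(a+b+1-i,\,i-1)$ for $i=1,\dots,b$; that is, $(a+1,b),(a,b+1),\dots,(2,b+a-1),(a+b,0),(a+b-1,1),\dots,(a+1,b-1)$.
   Context: $\mathbf{I}_n$ is the set of integer sequences $e_1\dots e_n$ with $0\le e_i<i$; $\mathbf{I}_n(\underline{10}0)$ is the set of $e\in\mathbf{I}_n$ with no positions $i$, $k$ with $i+1<k$ and $e_i>e_{i+1}=e_k$. For $e\in\mathbf{I}_n(\underline{10}0)$, an active site is a value $h\in\{0,\dots,n\}$ with $eh=e_1\dots e_nh\in\mathbf{I}_{n+1}(\underline{10}0)$. With the convention $e_0=0$ (used when $n=0$), $A_{\ge}(e)$ is the set of active sites $h$ with $h\ge e_n$ and $B_{<}(e)$ the set of active sites $h$ with $h<e_n$. -}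

module Defs where

open import Data.Nat using (ℕ; zero; suc; _+_; _∸_; _<_; _≤_; _≥_; _>_)
open import Data.Nat.Properties using (_<?_; _≟_; _≤?_)
open import Data.Fin using (Fin; toℕ)
open import Data.Fin.Properties using (all?)
open import Data.List using (List; []; _∷_; _++_; [_]; length; lookup; upTo; filter; map)
open import Data.Product using (_×_; _,_)
open import Relation.Binary.PropositionalEquality using (_≡_)
open import Relation.Nullary using (¬_; Dec)
open import Relation.Nullary.Decidable using (_×-dec_; _→-dec_; ¬?)

-- A sequence e = e₁ … eₙ is represented by the list (e₁ ∷ … ∷ eₙ ∷ []);
-- list position j (0-based, j : Fin n) holds e_{j+1}.

IsInversionSeq : List ℕ → Set
IsInversionSeq e = ∀ (j : Fin (length e)) → lookup e j < suc (toℕ j)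

Avoids100 : List ℕ → Set
Avoids100 e = ∀ (i i' k : Fin (length e)) → toℕ i' ≡ suc (toℕ i) → toℕ i' < toℕ k →
  ¬ (lookup e i > lookup e i' × lookup e i' ≡ lookup e k)

InI100 : List ℕ → Set
InI100 e = IsInversionSeq e × Avoids100 e

isInversionSeq? : ∀ e → Dec (IsInversionSeq e)
isInversionSeq? e = all? (λ j → lookup e j <? suc (toℕ j))

avoids100? : ∀ e → Dec (Avoids100 e)
avoids100? e = all? λ i → all? λ i' → all? λ k →
  (toℕ i' ≟ suc (toℕ i)) →-dec ((toℕ i' <? toℕ k) →-dec
    ¬? ((lookup e i' <? lookup e i) ×-dec (lookup e i' ≟ lookup e k)))

inI100? : ∀ e → Dec (InI100 e)
inI100? e = isInversionSeq? e ×-dec avoids100? e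

ActiveSite : List ℕ → ℕ → Set
ActiveSite e h = InI100 (e ++ [ h ])

activeSite? : ∀ e h → Dec (ActiveSite e h)
activeSite? e h = inI100? (e ++ [ h ])

activeSites : List ℕ → List ℕ
activeSites e = filter (activeSite? e) (upTo (suc (length e)))

-- last entry eₙ, with the convention e₀ = 0 for the empty sequence
lastE : List ℕ → ℕ
lastE []           = 0
lastE (x ∷ [])     = x
lastE (_ ∷ y ∷ ys) = lastE (y ∷ ys)

A≥ : List ℕ → List ℕ
A≥ e = filter (λ h → lastE e ≤? h) (activeSites e)

B< : List ℕ → List ℕ
B< e = filter (λ h → h <? lastE e) (activeSites e)

label : List ℕ → ℕ × ℕ
label e = length (A≥ e) , length (B< e)

oneTo : ℕ → List ℕ
oneTo m = map suc (upTo m)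

childLabels : ℕ → ℕ → List (ℕ × ℕ)
childLabels a b =
  map (λ i → (a + 2 ∸ i , b + i ∸ 1)) (oneTo a) ++
  map (λ i → (a + b + 1 ∸ i , i ∸ 1)) (oneTo b)

module Submission where

-- Write S for the active sites of e ∈ Iₙ(10̲0), x = eₙ, n = |e|, and call y a
-- descent bottom of e if y = e_{i+1} < e_i for some descent lying inside e.
-- (1) h is an active site of e iff h ≤ n and h is not a descent bottom of e.
-- (2) Appending h creates at most one new descent bottom, namely h when h < x,
--     and n+1 is always active; hence the active sites of eh are S, with h
--     removed when h < x, followed by n+1.
-- (3) Therefore, with counts h T = (#{y ∈ T | y ≥ h}, #{y ∈ T | y < h}),
--     L(eh) = counts h S + (1,0) when x ≤ h, and L(eh) = counts h S when h < x.
-- (4) For a strictly increasing list T the counts of its entries are its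
--     ranks: the j-th entry (from 0) has counts (|T| - j, j).
-- Since S is increasing, it splits as B<(e) ++ A≥(e); applying (4) to each
-- block gives exactly the two halves of childLabels, up to reordering.

open import Defs
open import Data.Nat using (ℕ; zero; suc; _+_; _∸_; _<_; _≤_; s≤s; z<s; s<s)
open import Data.Nat.Properties
open import Data.Fin using (Fin; toℕ; fromℕ<) renaming (zero to fzero; suc to fsuc)
open import Data.Fin.Properties using (toℕ<n; toℕ-fromℕ<)
open import Data.List using (List; []; _∷_; [_]; _++_; map; length; lookup; filter; upTo; applyUpTo)
open import Data.List.Properties
  using (filter-accept; filter-reject; filter-all; filter-none; filter-++; filter-≐;
         length-++; map-++; map-cong-local; map-∘; map-upTo; upTo-∷ʳ)
open import Data.List.Relation.Unary.All using (All; []; _∷_; tabulate; universal)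
  renaming (map to all-map; lookup to all-lookup)
open import Data.List.Relation.Unary.All.Properties using (all-filter; all-upTo)
open import Data.List.Relation.Unary.AllPairs using (AllPairs; []; _∷_)
import Data.List.Relation.Unary.AllPairs.Properties as AllPairs
open import Data.List.Membership.Propositional using (_∈_)
open import Data.List.Membership.Propositional.Properties using (∈-filter⁻)
open import Data.List.Relation.Unary.Any using (here; there)
open import Data.List.Relation.Binary.Permutation.Propositional using (_↭_; module PermutationReasoning)
open import Data.List.Relation.Binary.Permutation.Propositional.Properties using (++-comm)
open import Data.Product using (_×_; _,_; ∃-syntax; proj₁; proj₂)
open import Data.Sum using (_⊎_; inj₁; inj₂) renaming ([_,_] to either)
open import Function using (_∘_; id; _⇔_; mk⇔; Equivalence)
open import Relation.Nullary using (¬_; yes; no; contradiction)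
open import Relation.Nullary.Decidable using (¬?; _×-dec_)
open import Relation.Unary using (Decidable)
open import Relation.Unary.Properties using (_∩?_)
open import Relation.Binary.PropositionalEquality using (_≡_; _≢_; refl; sym; trans; cong; cong₂; subst; subst₂; module ≡-Reasoning)

open Equivalence using (to; from)

filter-cong-local : ∀ {P Q : ℕ → Set} (P? : Decidable P) (Q? : Decidable Q) {xs} →
  All (λ y → P y ⇔ Q y) xs → filter P? xs ≡ filter Q? xs
filter-cong-local P? Q? {[]} [] = refl
filter-cong-local P? Q? {x ∷ xs} (P⇔Q ∷ rest) with P? x | Q? x
... | yes p | yes q = cong (x ∷_) (filter-cong-local P? Q? rest)
... | yes p | no ¬q = contradiction (to P⇔Q p) ¬q
... | no ¬p | yes q = contradiction (from P⇔Q q) ¬p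
... | no ¬p | no ¬q = filter-cong-local P? Q? rest

filter-filter : ∀ {P Q : ℕ → Set} (P? : Decidable P) (Q? : Decidable Q) xs →
  filter Q? (filter P? xs) ≡ filter (P? ∩? Q?) xs
filter-filter P? Q? [] = refl
filter-filter P? Q? (x ∷ xs) with P? x
... | no _ = filter-filter P? Q? xs
... | yes _ with Q? x
...   | yes _ = cong (x ∷_) (filter-filter P? Q? xs)
...   | no _  = filter-filter P? Q? xs

Increasing : List ℕ → Set
Increasing = AllPairs _<_

counts : ℕ → List ℕ → ℕ × ℕ
counts h T = length (filter (h ≤?_) T) , length (filter (_<? h) T)

infixl 6 _⊕_
_⊕_ : ℕ × ℕ → ℕ × ℕ → ℕ × ℕ
(p , q) ⊕ (r , s) = p + r , q + s

counts-++ : ∀ h P Q → counts h (P ++ Q) ≡ counts h P ⊕ counts h Q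
counts-++ h P Q = cong₂ _,_ (count (h ≤?_)) (count (_<? h))
  where
  count : ∀ {R : ℕ → Set} (R? : Decidable R) →
          length (filter R? (P ++ Q)) ≡ length (filter R? P) + length (filter R? Q)
  count R? = trans (cong length (filter-++ R? P Q)) (length-++ (filter R? P))

counts-below : ∀ {h T} → All (_< h) T → counts h T ≡ (0 , length T)
counts-below {h} below =
  cong₂ _,_ (cong length (filter-none (h ≤?_) (all-map <⇒≱ below)))
            (cong length (filter-all (_<? h) below))

counts-above : ∀ {h T} → All (h ≤_) T → counts h T ≡ (length T , 0)
counts-above {h} above =
  cong₂ _,_ (cong length (filter-all (h ≤?_) above))
            (cong length (filter-none (_<? h) (all-map ≤⇒≯ above)))

counts-self : ∀ h T → counts h (h ∷ T) ≡ (1 , 0) ⊕ counts h T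
counts-self h T =
  cong₂ _,_ (cong length (filter-accept (h ≤?_) ≤-refl))
            (cong length (filter-reject (_<? h) (<-irrefl refl)))

counts-pass : ∀ {s h} T → s < h → counts h (s ∷ T) ≡ (0 , 1) ⊕ counts h T
counts-pass {h = h} T s<h =
  cong₂ _,_ (cong length (filter-reject (h ≤?_) (<⇒≱ s<h)))
            (cong length (filter-accept (_<? h) s<h))

ranks : ∀ {X : Set} (g : ℕ × ℕ → X) {T} → Increasing T →
  map (λ h → g (counts h T)) T ≡ applyUpTo (λ j → g (length T ∸ j , j)) (length T)
ranks g {[]} [] = refl
ranks g {t ∷ T} (t<T ∷ inc) = cong₂ _∷_ first rest
  where
  first : g (counts t (t ∷ T)) ≡ g (suc (length T) , 0)
  first = cong g (trans (counts-self t T) (cong ((1 , 0) ⊕_) (counts-above (all-map <⇒≤ t<T))))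
  rest : map (λ h → g (counts h (t ∷ T))) T ≡ applyUpTo (λ j → g (length T ∸ j , suc j)) (length T)
  rest = trans (map-cong-local (all-map (cong g ∘ counts-pass T) t<T))
               (ranks (g ∘ ((0 , 1) ⊕_)) inc)

without : ℕ → List ℕ → List ℕ
without h = filter (λ y → ¬? (y ≟ h))

counts-without : ∀ {h S} → Increasing S → h ∈ S → counts h (without h S) ⊕ (1 , 0) ≡ counts h S
counts-without {h} {h ∷ S} (h<S ∷ _) (here refl) = begin
  counts h (without h (h ∷ S)) ⊕ (1 , 0) ≡⟨ cong (λ T → counts h T ⊕ (1 , 0)) deleted ⟩
  counts h S ⊕ (1 , 0)                   ≡⟨ cong₂ _,_ (+-comm _ 1) (+-identityʳ _) ⟩
  (1 , 0) ⊕ counts h S                   ≡⟨ counts-self h S ⟨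
  counts h (h ∷ S)                       ∎
  where
  open ≡-Reasoning
  deleted : without h (h ∷ S) ≡ S
  deleted = trans (filter-reject (λ y → ¬? (y ≟ h)) (λ h≢h → h≢h refl))
                  (filter-all (λ y → ¬? (y ≟ h)) (all-map >⇒≢ h<S))
counts-without {h} {s ∷ S} (s<S ∷ inc) (there h∈S) = begin
  counts h (without h (s ∷ S)) ⊕ (1 , 0)      ≡⟨ cong (λ T → counts h T ⊕ (1 , 0)) kept ⟩
  counts h (s ∷ without h S) ⊕ (1 , 0)        ≡⟨ cong (_⊕ (1 , 0)) (counts-pass (without h S) s<h) ⟩
  (0 , 1) ⊕ counts h (without h S) ⊕ (1 , 0)  ≡⟨ cong ((0 , 1) ⊕_) (counts-without inc h∈S) ⟩
  (0 , 1) ⊕ counts h S                        ≡⟨ counts-pass S s<h ⟨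
  counts h (s ∷ S)                            ∎
  where
  open ≡-Reasoning
  s<h : s < h
  s<h = all-lookup s<S h∈S
  kept : without h (s ∷ S) ≡ s ∷ without h S
  kept = filter-accept (λ y → ¬? (y ≟ h)) (<⇒≢ s<h)

split : ∀ x {S} → Increasing S → filter (_<? x) S ++ filter (x ≤?_) S ≡ S
split x {[]} [] = refl
split x {s ∷ S} (s<S ∷ inc) with s <? x
... | yes s<x = begin
  filter (_<? x) (s ∷ S) ++ filter (x ≤?_) (s ∷ S)
    ≡⟨ cong₂ _++_ (filter-accept (_<? x) s<x) (filter-reject (x ≤?_) (<⇒≱ s<x)) ⟩
  s ∷ (filter (_<? x) S ++ filter (x ≤?_) S)
    ≡⟨ cong (s ∷_) (split x inc) ⟩
  s ∷ S ∎
  where open ≡-Reasoning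
... | no s≮x = begin
  filter (_<? x) (s ∷ S) ++ filter (x ≤?_) (s ∷ S)
    ≡⟨ cong₂ _++_ (trans (filter-reject (_<? x) s≮x) (filter-none (_<? x) (all-map (≤⇒≯ ∘ above) s<S)))
                  (filter-accept (x ≤?_) x≤s) ⟩
  s ∷ filter (x ≤?_) S
    ≡⟨ cong (s ∷_) (filter-all (x ≤?_) (all-map above s<S)) ⟩
  s ∷ S ∎
  where
  open ≡-Reasoning
  x≤s : x ≤ s
  x≤s = ≮⇒≥ s≮x
  above : ∀ {y} → s < y → x ≤ y
  above s<y = ≤-trans x≤s (<⇒≤ s<y)

applyUpTo-cong : ∀ {X : Set} {F G : ℕ → X} m → (∀ {j} → j < m → F j ≡ G j) → applyUpTo F m ≡ applyUpTo G m
applyUpTo-cong zero    _  = refl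
applyUpTo-cong (suc m) eq = cong₂ _∷_ (eq z<s) (applyUpTo-cong m (eq ∘ s<s))

map-oneTo : ∀ {X : Set} (F : ℕ → X) {G : ℕ → X} m → (∀ {j} → j < m → F (suc j) ≡ G j) →
  map F (oneTo m) ≡ applyUpTo G m
map-oneTo F m eq = trans (sym (map-∘ (upTo m))) (trans (map-upTo (F ∘ suc) m) (applyUpTo-cong m eq))

childLabels-ranks : ∀ a b → childLabels a b ≡
  applyUpTo (λ j → (0 , b) ⊕ (a ∸ j , j) ⊕ (1 , 0)) a ++ applyUpTo (λ j → (b ∸ j , j) ⊕ (a , 0)) b
childLabels-ranks a b = cong₂ _++_ (map-oneTo _ a upper) (map-oneTo _ b lower)
  where
  upper : ∀ {j} → j < a → (a + 2 ∸ suc j , b + suc j ∸ 1) ≡ (a ∸ j + 1 , b + j + 0)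
  upper {j} j<a = cong₂ _,_ (trans (cong (_∸ suc j) (+-suc a 1)) (+-∸-comm 1 (<⇒≤ j<a)))
                            (trans (cong (_∸ 1) (+-suc b j)) (sym (+-identityʳ (b + j))))
  lower : ∀ {j} → j < b → (a + b + 1 ∸ suc j , suc j ∸ 1) ≡ (b ∸ j + a , j + 0)
  lower {j} j<b = cong₂ _,_ (trans (cong (_∸ suc j) (trans (+-comm (a + b) 1) (cong suc (+-comm a b))))
                                   (+-∸-comm a (<⇒≤ j<b)))
                            (sym (+-identityʳ j))

-- e at a natural-number index (0 beyond the end)
at : List ℕ → ℕ → ℕ
at []       _       = 0
at (x ∷ _)  zero    = x
at (_ ∷ xs) (suc j) = at xs j

at-lookup : ∀ e (j : Fin (length e)) → lookup e j ≡ at e (toℕ j)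
at-lookup (x ∷ e) fzero    = refl
at-lookup (x ∷ e) (fsuc j) = at-lookup e j

at-fromℕ< : ∀ e {j} (j<n : j < length e) → lookup e (fromℕ< j<n) ≡ at e j
at-fromℕ< e {j} j<n = trans (at-lookup e (fromℕ< j<n)) (cong (at e) (toℕ-fromℕ< j<n))

Inversion : List ℕ → Set
Inversion e = ∀ j → j < length e → at e j < suc j

Avoiding : List ℕ → Set
Avoiding e = ∀ i k → suc i < k → k < length e → at e (suc i) < at e i → at e (suc i) ≢ at e k

DescentBottom : List ℕ → ℕ → Set
DescentBottom e y = ∃[ i ] suc i < length e × at e (suc i) < at e i × at e (suc i) ≡ y

inversion⇔ : ∀ e → IsInversionSeq e ⇔ Inversion e
inversion⇔ e = mk⇔
  (λ I j j<n → subst₂ (λ u v → u < suc v) (at-fromℕ< e j<n) (toℕ-fromℕ< j<n) (I (fromℕ< j<n)))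
  (λ I j → subst (_< suc (toℕ j)) (sym (at-lookup e j)) (I (toℕ j) (toℕ<n j)))

avoiding⇔ : ∀ e → Avoids100 e ⇔ Avoiding e
avoiding⇔ e = mk⇔ fromFin toFin
  where
  fromFin : Avoids100 e → Avoiding e
  fromFin A i k si<k k<n desc eq = A (fromℕ< i<n) (fromℕ< si<n) (fromℕ< k<n) adjacent later (desc′ , eq′)
    where
    si<n : suc i < length e
    si<n = <-trans si<k k<n
    i<n : i < length e
    i<n = <-trans (n<1+n i) si<n
    adjacent : toℕ (fromℕ< si<n) ≡ suc (toℕ (fromℕ< i<n))
    adjacent = trans (toℕ-fromℕ< si<n) (cong suc (sym (toℕ-fromℕ< i<n)))
    later : toℕ (fromℕ< si<n) < toℕ (fromℕ< k<n)
    later = subst₂ _<_ (sym (toℕ-fromℕ< si<n)) (sym (toℕ-fromℕ< k<n)) si<k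
    desc′ : lookup e (fromℕ< si<n) < lookup e (fromℕ< i<n)
    desc′ = subst₂ _<_ (sym (at-fromℕ< e si<n)) (sym (at-fromℕ< e i<n)) desc
    eq′ : lookup e (fromℕ< si<n) ≡ lookup e (fromℕ< k<n)
    eq′ = trans (at-fromℕ< e si<n) (trans eq (sym (at-fromℕ< e k<n)))
  toFin : Avoiding e → Avoids100 e
  toFin A i i′ k i′≡si i′<k (desc , eq) =
    A (toℕ i) (toℕ k) (subst (_< toℕ k) i′≡si i′<k) (toℕ<n k)
      (subst₂ _<_ at-i′ (at-lookup e i) desc) (trans (sym at-i′) (trans eq (at-lookup e k)))
    where
    at-i′ : lookup e i′ ≡ at e (suc (toℕ i))
    at-i′ = trans (at-lookup e i′) (cong (at e) i′≡si)

length-snoc : ∀ {A : Set} (e : List A) h → length (e ++ [ h ]) ≡ suc (length e)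
length-snoc e h = trans (length-++ e) (+-comm (length e) 1)

index-snoc : ∀ (e : List ℕ) h {j} → j < length (e ++ [ h ]) → j < length e ⊎ j ≡ length e
index-snoc e h {j} j<n+1 = m<1+n⇒m<n∨m≡n (subst (j <_) (length-snoc e h) j<n+1)

last-index : ∀ (e : List ℕ) h → length e < length (e ++ [ h ])
last-index e h = subst (length e <_) (sym (length-snoc e h)) ≤-refl

at-snoc : ∀ e h {j} → j < length e → at (e ++ [ h ]) j ≡ at e j
at-snoc (x ∷ e) h {zero}  _         = refl
at-snoc (x ∷ e) h {suc j} (s≤s j<n) = at-snoc e h j<n

at-snoc-last : ∀ e h → at (e ++ [ h ]) (length e) ≡ h
at-snoc-last []      h = refl
at-snoc-last (x ∷ e) h = at-snoc-last e h

lastE-snoc : ∀ e h → lastE (e ++ [ h ]) ≡ h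
lastE-snoc []           h = refl
lastE-snoc (x ∷ [])     h = refl
lastE-snoc (x ∷ y ∷ ys) h = lastE-snoc (y ∷ ys) h

lastE-at : ∀ e i → suc i ≡ length e → lastE e ≡ at e i
lastE-at (x ∷ [])     zero    _  = refl
lastE-at (x ∷ y ∷ ys) (suc i) eq = lastE-at (y ∷ ys) i (suc-injective eq)

descent-snoc : ∀ e h {i y} → suc i < length e →
  at (e ++ [ h ]) (suc i) < at (e ++ [ h ]) i × at (e ++ [ h ]) (suc i) ≡ y →
  at e (suc i) < at e i × at e (suc i) ≡ y
descent-snoc e h {i} si<n (desc , eq)
  rewrite at-snoc e h si<n | at-snoc e h (<-trans (n<1+n i) si<n) = desc , eq

descent-snoc⁻ : ∀ e h {i y} → suc i < length e →
  at e (suc i) < at e i × at e (suc i) ≡ y →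
  at (e ++ [ h ]) (suc i) < at (e ++ [ h ]) i × at (e ++ [ h ]) (suc i) ≡ y
descent-snoc⁻ e h {i} si<n (desc , eq)
  rewrite at-snoc e h si<n | at-snoc e h (<-trans (n<1+n i) si<n) = desc , eq

inversion-snoc : ∀ e h → Inversion e → Inversion (e ++ [ h ]) ⇔ h ≤ length e
inversion-snoc e h I = mk⇔ bound extend
  where
  bound : Inversion (e ++ [ h ]) → h ≤ length e
  bound I′ = ≤-pred (subst (_< suc (length e)) (at-snoc-last e h) (I′ (length e) (last-index e h)))
  extend : h ≤ length e → Inversion (e ++ [ h ])
  extend h≤n j j<n+1 with index-snoc e h j<n+1
  ... | inj₁ j<n  = subst (_< suc j) (sym (at-snoc e h j<n)) (I j j<n)
  ... | inj₂ refl = subst (_< suc j) (sym (at-snoc-last e h)) (s≤s h≤n)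

avoiding-snoc : ∀ e h → Avoiding e → Avoiding (e ++ [ h ]) ⇔ (¬ DescentBottom e h)
avoiding-snoc e h A = mk⇔ fresh extend
  where
  fresh : Avoiding (e ++ [ h ]) → ¬ DescentBottom e h
  fresh A′ (i , si<n , desc) with descent-snoc⁻ e h si<n desc
  ... | desc′ , eq′ = A′ i (length e) si<n (last-index e h) desc′ (trans eq′ (sym (at-snoc-last e h)))
  extend : ¬ DescentBottom e h → Avoiding (e ++ [ h ])
  extend fresh i k si<k k<n+1 desc eq with index-snoc e h k<n+1
  ... | inj₁ k<n = A i k si<k k<n (proj₁ inside) (trans (proj₂ inside) (at-snoc e h k<n))
    where
    inside : at e (suc i) < at e i × at e (suc i) ≡ at (e ++ [ h ]) k
    inside = descent-snoc e h (<-trans si<k k<n) (desc , eq)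
  ... | inj₂ refl = fresh (i , si<k , descent-snoc e h si<k (desc , trans eq (at-snoc-last e h)))

activeSite⇔ : ∀ e h → InI100 e → ActiveSite e h ⇔ (h ≤ length e × ¬ DescentBottom e h)
activeSite⇔ e h (I , A) = mk⇔
  (λ (I′ , A′) → to (inversion-snoc e h Iₑ) (to (inversion⇔ (e ++ [ h ])) I′) ,
                 to (avoiding-snoc e h Aₑ) (to (avoiding⇔ (e ++ [ h ])) A′))
  (λ (h≤n , fresh) → from (inversion⇔ (e ++ [ h ])) (from (inversion-snoc e h Iₑ) h≤n) ,
                     from (avoiding⇔ (e ++ [ h ])) (from (avoiding-snoc e h Aₑ) fresh))
  where
  Iₑ : Inversion e
  Iₑ = to (inversion⇔ e) I
  Aₑ : Avoiding e
  Aₑ = to (avoiding⇔ e) A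

descentBottom-bound : ∀ e {y} → Inversion e → DescentBottom e y → y < length e
descentBottom-bound e I (i , si<n , desc , refl) = <-trans (<-≤-trans desc (≤-pred (I i i<n))) i<n
  where i<n = <-trans (n<1+n i) si<n

NewBottom : List ℕ → ℕ → ℕ → Set
NewBottom e h y = h < lastE e × y ≡ h

notNewBottom? : ∀ e h → Decidable (λ y → ¬ NewBottom e h y)
notNewBottom? e h y = ¬? ((h <? lastE e) ×-dec (y ≟ h))

newBottom-descent : ∀ e h → h < lastE e → DescentBottom (e ++ [ h ]) h
newBottom-descent []      h ()
newBottom-descent (x ∷ e) h h<x =
  length e , last-index (x ∷ e) h ,
  subst₂ _<_ (sym (at-snoc-last (x ∷ e) h))
             (trans (lastE-at (x ∷ e) _ refl) (sym (at-snoc (x ∷ e) h ≤-refl))) h<x ,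
  at-snoc-last (x ∷ e) h

descentBottom-snoc : ∀ e h {y} → DescentBottom (e ++ [ h ]) y ⇔ (DescentBottom e y ⊎ NewBottom e h y)
descentBottom-snoc e h = mk⇔ classify create
  where
  classify : ∀ {y} → DescentBottom (e ++ [ h ]) y → DescentBottom e y ⊎ NewBottom e h y
  classify (i , si<n+1 , desc , eq) with index-snoc e h si<n+1
  ... | inj₁ si<n = inj₁ (i , si<n , descent-snoc e h si<n (desc , eq))
  ... | inj₂ si≡n =
    inj₂ (subst₂ _<_ top bottom desc , trans (sym eq) top)
    where
    top : at (e ++ [ h ]) (suc i) ≡ h
    top = trans (cong (at (e ++ [ h ])) si≡n) (at-snoc-last e h)
    bottom : at (e ++ [ h ]) i ≡ lastE e
    bottom = trans (at-snoc e h (subst (_ <_) si≡n ≤-refl)) (sym (lastE-at e _ si≡n))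
  create : ∀ {y} → DescentBottom e y ⊎ NewBottom e h y → DescentBottom (e ++ [ h ]) y
  create (inj₁ (i , si<n , desc)) = i , <-trans si<n (last-index e h) , descent-snoc⁻ e h si<n desc
  create (inj₂ (h<x , refl)) = newBottom-descent e h h<x

activeSite-snoc : ∀ e h y → InI100 e → ActiveSite e h → y ≤ length e →
  ActiveSite (e ++ [ h ]) y ⇔ (ActiveSite e y × ¬ NewBottom e h y)
activeSite-snoc e h y inI act y≤n = mk⇔
  (λ act′ → let fresh′ = proj₂ (to (activeSite⇔ (e ++ [ h ]) y act) act′) in
    from (activeSite⇔ e y inI) (y≤n , fresh′ ∘ from (descentBottom-snoc e h) ∘ inj₁) ,
    fresh′ ∘ from (descentBottom-snoc e h) ∘ inj₂)
  (λ (act″ , notNew) → from (activeSite⇔ (e ++ [ h ]) y act)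
    ( subst (y ≤_) (sym (length-snoc e h)) (≤-trans y≤n (n≤1+n _))
    , either (proj₂ (to (activeSite⇔ e y inI) act″)) notNew ∘ to (descentBottom-snoc e h)))

-- (2c) n+1 is always active in a child, since descent bottoms are below the length.
newSite-active : ∀ e h → ActiveSite e h → ActiveSite (e ++ [ h ]) (suc (length e))
newSite-active e h act = from (activeSite⇔ (e ++ [ h ]) _ act)
  ( ≤-reflexive (sym (length-snoc e h))
  , λ bottom → <-irrefl (sym (length-snoc e h))
      (descentBottom-bound (e ++ [ h ]) (to (inversion⇔ (e ++ [ h ])) (proj₁ act)) bottom))

activeSites-snoc : ∀ e h → InI100 e → ActiveSite e h →
  activeSites (e ++ [ h ]) ≡ filter (notNewBottom? e h) (activeSites e) ++ [ suc (length e) ]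
activeSites-snoc e h inI act = begin
  filter (activeSite? eh) (upTo (suc (length eh)))
    ≡⟨ cong (filter (activeSite? eh)) sites ⟩
  filter (activeSite? eh) (upTo (suc n) ++ [ suc n ])
    ≡⟨ filter-++ (activeSite? eh) (upTo (suc n)) [ suc n ] ⟩
  filter (activeSite? eh) (upTo (suc n)) ++ filter (activeSite? eh) [ suc n ]
    ≡⟨ cong₂ _++_ old (filter-accept (activeSite? eh) (newSite-active e h act)) ⟩
  filter (activeSite? e ∩? notNewBottom? e h) (upTo (suc n)) ++ [ suc n ]
    ≡⟨ cong (_++ [ suc n ]) (filter-filter (activeSite? e) (notNewBottom? e h) (upTo (suc n))) ⟨
  filter (notNewBottom? e h) (activeSites e) ++ [ suc n ] ∎
  where
  open ≡-Reasoning
  eh : List ℕ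
  eh = e ++ [ h ]
  n : ℕ
  n = length e
  sites : upTo (suc (length eh)) ≡ upTo (suc n) ++ [ suc n ]
  sites = trans (cong (upTo ∘ suc) (length-snoc e h)) (sym (upTo-∷ʳ (suc n)))
  old : filter (activeSite? eh) (upTo (suc n)) ≡ filter (activeSite? e ∩? notNewBottom? e h) (upTo (suc n))
  old = filter-cong-local (activeSite? eh) (activeSite? e ∩? notNewBottom? e h)
          (all-map (λ y<n+1 → activeSite-snoc e h _ inI act (≤-pred y<n+1)) (all-upTo (suc n)))

label-snoc : ∀ e h {T k} → activeSites (e ++ [ h ]) ≡ T ++ [ k ] → h ≤ k →
  label (e ++ [ h ]) ≡ counts h T ⊕ (1 , 0)
label-snoc e h {T} {k} sites h≤k = begin
  counts (lastE (e ++ [ h ])) (activeSites (e ++ [ h ])) ≡⟨ cong₂ counts (lastE-snoc e h) sites ⟩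
  counts h (T ++ [ k ])                                  ≡⟨ counts-++ h T [ k ] ⟩
  counts h T ⊕ counts h [ k ]                            ≡⟨ cong (counts h T ⊕_) (counts-above (h≤k ∷ [])) ⟩
  counts h T ⊕ (1 , 0)                                   ∎
  where open ≡-Reasoning

module Children (e : List ℕ) (inI : InI100 e) where
  n x : ℕ
  n = length e
  x = lastE e

  S As Bs : List ℕ
  S = activeSites e
  As = A≥ e
  Bs = B< e

  child : ℕ → ℕ × ℕ
  child h = label (e ++ [ h ])

  increasing : Increasing S
  increasing = AllPairs.filter⁺ (activeSite? e) (AllPairs.applyUpTo⁺₁ id (suc n) (λ i<j _ → i<j))

  site-active : ∀ {h} → h ∈ S → ActiveSite e h
  site-active h∈S = proj₂ (∈-filter⁻ (activeSite? e) h∈S)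

  below-new-site : ∀ {h} → h ∈ S → h ≤ suc n
  below-new-site h∈S = ≤-trans (proj₁ (to (activeSite⇔ e _ inI) (site-active h∈S))) (n≤1+n n)

  child-sites : ∀ {h} → h ∈ S → activeSites (e ++ [ h ]) ≡ filter (notNewBottom? e h) S ++ [ suc n ]
  child-sites h∈S = activeSites-snoc e _ inI (site-active h∈S)

  child-above : ∀ {h} → h ∈ S → x ≤ h → child h ≡ counts h S ⊕ (1 , 0)
  child-above {h} h∈S x≤h = label-snoc e h (trans (child-sites h∈S) unchanged) (below-new-site h∈S)
    where
    unchanged : filter (notNewBottom? e h) S ++ [ suc n ] ≡ S ++ [ suc n ]
    unchanged = cong (_++ [ suc n ]) (filter-all (notNewBottom? e h) (universal (λ _ (h<x , _) → <⇒≱ h<x x≤h) S))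

  child-below : ∀ {h} → h ∈ S → h < x → child h ≡ counts h S
  child-below {h} h∈S h<x = trans (label-snoc e h (trans (child-sites h∈S) removed) (below-new-site h∈S))
                                  (counts-without increasing h∈S)
    where
    removed : filter (notNewBottom? e h) S ++ [ suc n ] ≡ without h S ++ [ suc n ]
    removed = cong (_++ [ suc n ]) (filter-≐ (notNewBottom? e h) (λ y → ¬? (y ≟ h))
      ((λ notNew y≡h → notNew (h<x , y≡h)) , λ y≢h (_ , y≡h) → y≢h y≡h) S)

  a b : ℕ
  a = length As
  b = length Bs

  blocks : Bs ++ As ≡ S
  blocks = split x increasing

  counts-upper : ∀ {h} → x ≤ h → counts h S ≡ (0 , b) ⊕ counts h As
  counts-upper {h} x≤h = begin
    counts h S                     ≡⟨ cong (counts h) blocks ⟨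
    counts h (Bs ++ As)            ≡⟨ counts-++ h Bs As ⟩
    counts h Bs ⊕ counts h As      ≡⟨ cong (_⊕ counts h As) (counts-below (all-map (λ y<x → <-≤-trans y<x x≤h) (all-filter (_<? x) S))) ⟩
    (0 , b) ⊕ counts h As          ∎
    where open ≡-Reasoning

  counts-lower : ∀ {h} → h < x → counts h S ≡ counts h Bs ⊕ (a , 0)
  counts-lower {h} h<x = begin
    counts h S                     ≡⟨ cong (counts h) blocks ⟨
    counts h (Bs ++ As)            ≡⟨ counts-++ h Bs As ⟩
    counts h Bs ⊕ counts h As      ≡⟨ cong (counts h Bs ⊕_) (counts-above (all-map (≤-trans (<⇒≤ h<x)) (all-filter (x ≤?_) S))) ⟩
    counts h Bs ⊕ (a , 0)          ∎
    where open ≡-Reasoning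

  labels-upper : map child As ≡ applyUpTo (λ j → (0 , b) ⊕ (a ∸ j , j) ⊕ (1 , 0)) a
  labels-upper = trans (map-cong-local (tabulate label-of)) (ranks (λ c → (0 , b) ⊕ c ⊕ (1 , 0)) (AllPairs.filter⁺ (x ≤?_) increasing))
    where
    label-of : ∀ {h} → h ∈ As → child h ≡ (0 , b) ⊕ counts h As ⊕ (1 , 0)
    label-of h∈As with ∈-filter⁻ (x ≤?_) h∈As
    ... | h∈S , x≤h = trans (child-above h∈S x≤h) (cong (_⊕ (1 , 0)) (counts-upper x≤h))

  labels-lower : map child Bs ≡ applyUpTo (λ j → (b ∸ j , j) ⊕ (a , 0)) b
  labels-lower = trans (map-cong-local (tabulate label-of)) (ranks (_⊕ (a , 0)) (AllPairs.filter⁺ (_<? x) increasing))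
    where
    label-of : ∀ {h} → h ∈ Bs → child h ≡ counts h Bs ⊕ (a , 0)
    label-of h∈Bs with ∈-filter⁻ (_<? x) h∈Bs
    ... | h∈S , h<x = trans (child-below h∈S h<x) (counts-lower h<x)

  children : map child S ↭ childLabels a b
  children = begin
    map child S                      ≡⟨ cong (map child) blocks ⟨
    map child (Bs ++ As)             ≡⟨ map-++ child Bs As ⟩
    map child Bs ++ map child As     ↭⟨ ++-comm (map child Bs) (map child As) ⟩
    map child As ++ map child Bs     ≡⟨ cong₂ _++_ labels-upper labels-lower ⟩
    applyUpTo (λ j → (0 , b) ⊕ (a ∸ j , j) ⊕ (1 , 0)) a ++ applyUpTo (λ j → (b ∸ j , j) ⊕ (a , 0)) b
                                     ≡⟨ childLabels-ranks a b ⟨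
    childLabels a b                  ∎
    where open PermutationReasoning

proposition3p9 : (label [] ≡ (1 , 0))
    × (∀ (e : List ℕ) (a b : ℕ) → InI100 e → label e ≡ (a , b) →
        map (λ h → label (e ++ [ h ])) (activeSites e) ↭ childLabels a b)
-- The root label (1 , 0) holds by computation: 0 is the only active site of
-- the empty sequence and e₀ = 0.
proposition3p9 = refl , λ { e _ _ inI refl → Children.children e inI }
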